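{- Let $\mathcal{T}'$ be the axiomatic system consisting of the axioms A1, A2, A3 described in the context (i.e. $\mathcal{T}$ without A4). Then $\mathcal{T}'\not\vdash \mathrm{P}=\mathrm{NP}$.
   Context: Fix finite alphabets $\Sigma\subseteq\Gamma$ with blank $\triangle\in\Gamma\setminus\Sigma$, and $Q=Q_T=\{h\}\cup\{q_i\mid i\ge0\}$. $INST=\{[(q,a)\rightarrow(p,b,D)]\mid p,q\in Q_T,a,b\in\Gamma,D\in\{R,L\}\}$; $CONF=\{(q,x\underline{a}z)\mid q\in Q_T,x,z\in\Gamma^*,a\in\Gamma\}$ (underline marks head); $C_{0,x}=(q_0,\underline{\triangle}x)$. $\Xi$ is the set of finite $M\subseteq INST$ such that two instructions of $M$ with the same left side $(q,a)$ are identical. The language has a function symbol $TB:CONF\times INST\to CONF\cup\{\perp\}$ and a predicate symbol $SB:CONF\to\{YES,NO\}$. Define: $x\in L(M)$ iff there exist $n\in\mathbb{N}$, $\tau_1,\dots,\tau_n\in M$, $C_1,\dots,C_n\in CONF$ with $C_1=TB(C_{0,x},\tau_1)$, $C_i=TB(C_{i-1},\tau_i)$ for $1<i\le n$, $SB(C_n)=YES$, and $TB(C_n,\iota)=\perp$ for all $\iota\in M$; $time_M(x)=n$ iff such data exist for this $n$. $\mathrm{P}$ is the class of languages $L\subseteq\Sigma^*$ for which there are $M\in\Xi$ and a polynomial $p$ with $L(M)=L$ and $time_M(x)<p(|x|)$ for all $x\in L$; $L\in\mathrm{NP}$ iff there are $J\in\mathrm{P}$ and a polynomial $q$ with $x\in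 L\Leftrightarrow\exists y\in\Sigma^*(|y|\le q(|x|)\wedge(x,y)\in J)$ for all $x\in\Sigma^*$; "$\mathrm{P}=\mathrm{NP}$" is the statement that these classes coincide. Axioms: (A1) for all $x,y\in\Sigma^*$, $a,b_1,b_2,c\in\Sigma$, $q,p\in Q$: $TB((q,xb_1\underline{a}b_2y),[(q,a)\rightarrow(p,c,R)])=(p,xb_1c\underline{b_2}y)$ and $TB((q,xb_1\underline{a}b_2y),[(q,a)\rightarrow(p,c,L)])=(p,x\underline{b_1}cb_2y)$. (A2) If $SB(C)=YES$ then for some $x\in\Sigma^*$, $C=(h,\underline{\triangle}x)$ or $C=(h,x\underline{\triangle})$. (A3) For all $x\in\Sigma^*$, $SB((h,\underline{\triangle}x))=YES$. (The omitted axiom A4 states: for all $x\in\Sigma^*$, $SB((h,x\underline{\triangle}))=YES$.) -}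

module Defs where

open import Level using (Level)
open import Data.Nat using (ℕ; zero; suc; _+_; _*_; _≤_; _<_)
open import Data.Fin using (Fin)
open import Data.Bool using (Bool; true; false)
open import Data.Maybe using (Maybe; just; nothing)
open import Data.List using (List; []; _∷_; _++_; map; length)
open import Data.List.Membership.Propositional using (_∈_)
open import Data.Product using (Σ; ∃; ∃-syntax; _×_; _,_; proj₁)
open import Data.Sum using (_⊎_)
open import Relation.Binary.PropositionalEquality using (_≡_; _≢_)
open import Relation.Nullary using (¬_)
open import Function.Bundles using (_↔_; _⇔_)
open import Function.Definitions using (Injective)

record Alphabets : Set₁ where
  field
    Σₐ     : Set
    Γₐ     : Set
    emb    : Σₐ → Γₐ
    emb-inj : Injective _≡_ _≡_ emb
    blank  : Γₐ
    blank∉Σ : ∀ (s : Σₐ) → emb s ≢ blank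
    nΣ nΓ  : ℕ
    Σ-finite : Σₐ ↔ Fin nΣ
    Γ-finite : Γₐ ↔ Fin nΓ
    Σ-nonempty : Σₐ

data State : Set where
  h : State
  q : ℕ → State

q₀ : State
q₀ = q 0

data Dir : Set where
  R L : Dir

Poly : Set
Poly = List ℕ

evalPoly : Poly → ℕ → ℕ
evalPoly []       n = 0
evalPoly (c ∷ cs) n = c + n * evalPoly cs n

module Machines (A : Alphabets) where
  open Alphabets A

  record Inst : Set where
    constructor [_,_⇒_,_,_]
    field
      src   : State
      read  : Γₐ
      tgt   : State
      write : Γₐ
      dir   : Dir

  -- A configuration (q, x a̲ z): state, tape left of head (in order),
  -- scanned symbol, tape right of head (in order).
  record Conf : Set where
    constructor conf
    field
      state : State
      left  : List Γₐ
      head  : Γₐ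
      right : List Γₐ

  Word : Set
  Word = List Σₐ

  ⌜_⌝ : Word → List Γₐ
  ⌜ x ⌝ = map emb x

  C₀ : Word → Conf
  C₀ x = conf q₀ [] blank ⌜ x ⌝

  Deterministic : List Inst → Set
  Deterministic M = ∀ {ι ι′} → ι ∈ M → ι′ ∈ M →
    Inst.src ι ≡ Inst.src ι′ → Inst.read ι ≡ Inst.read ι′ → ι ≡ ι′

  Ξ : Set
  Ξ = Σ (List Inst) Deterministic

  -- An interpretation of the symbols TB and SB.
  -- TB : CONF × INST → CONF ∪ {⊥}   (⊥ = nothing)
  -- SB : CONF → {YES, NO}           (YES = true, NO = false)
  record Interp : Set where
    field
      TB : Conf → Inst → Maybe Conf
      SB : Conf → Bool

  module _ (I : Interp) where
    open Interp I

    AxA1 : Set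
    AxA1 = ∀ (x y : Word) (a b₁ b₂ c : Σₐ) (s p : State) →
      (TB (conf s (⌜ x ⌝ ++ emb b₁ ∷ []) (emb a) (emb b₂ ∷ ⌜ y ⌝))
          [ s , emb a ⇒ p , emb c , R ]
        ≡ just (conf p (⌜ x ⌝ ++ emb b₁ ∷ emb c ∷ []) (emb b₂) ⌜ y ⌝))
      × (TB (conf s (⌜ x ⌝ ++ emb b₁ ∷ []) (emb a) (emb b₂ ∷ ⌜ y ⌝))
          [ s , emb a ⇒ p , emb c , L ]
        ≡ just (conf p ⌜ x ⌝ (emb b₁) (emb c ∷ emb b₂ ∷ ⌜ y ⌝)))

    AxA2 : Set
    AxA2 = ∀ (C : Conf) → SB C ≡ true →
      ∃[ x ] (C ≡ conf h [] blank ⌜ x ⌝ ⊎ C ≡ conf h ⌜ x ⌝ blank [])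

    AxA3 : Set
    AxA3 = ∀ (x : Word) → SB (conf h [] blank ⌜ x ⌝) ≡ true

    data Steps (M : List Inst) : Conf → ℕ → Conf → Set where
      done : ∀ {C} → Steps M C 0 C
      step : ∀ {C C′ C″ n} (τ : Inst) → τ ∈ M → TB C τ ≡ just C′ →
             Steps M C′ n C″ → Steps M C (suc n) C″

    TimeIs : List Inst → Word → ℕ → Set
    TimeIs M x n = ∃[ C ] (Steps M (C₀ x) n C × SB C ≡ true
                           × (∀ ι → ι ∈ M → TB C ι ≡ nothing))

    InL : List Inst → Word → Set
    InL M x = ∃[ n ] TimeIs M x n

    Language : Set₁
    Language = Word → Set

    InP : Language → Set
    InP Lg = Σ Ξ λ M → Σ Poly λ p →
      ((∀ x → Lg x ⇔ InL (proj₁ M) x)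
       × (∀ x → Lg x → ∀ n → TimeIs (proj₁ M) x n
                       → n < evalPoly p (length x)))

    InNP : (Word → Word → Word) → Language → Set₁
    InNP pair Lg = Σ Language λ J → (InP J × ∃[ r ]
      (∀ x → Lg x ⇔ (∃[ y ] (length y ≤ evalPoly r (length x) × J (pair x y)))))

    PeqNP : (Word → Word → Word) → Set₁
    PeqNP pair = ∀ (Lg : Language) → InP Lg ⇔ InNP pair Lg

{-# OPTIONS --safe #-}
-- Axiom A1 only constrains TB at configurations with a symbol on both sides of the head, and
-- A2, A3 let SB accept exactly the configurations (h, △̲x).  So TB may send the initial
-- configuration (q₀, △̲x) of every nonempty word x in one step to the accepting halting
-- configuration (h, △̲x), while (q₀, △̲) is stuck and rejected.  Every machine then accepts
-- either no word or exactly the nonempty words, each in time 1.  Hence the nonempty words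
-- form a language in P, Σ* is not in P, yet Σ* is in NP: for every x some y of length at
-- most 1 makes the code of (x, y) nonempty.
module Submission where

open import Defs
open import Data.Bool using (Bool; false)
open import Data.Bool.Properties using (T-≡)
open import Data.Empty using (⊥-elim)
open import Data.Fin using (Fin)
open import Data.Fin.Properties using (any?) renaming (_≟_ to _≟Fin_)
open import Data.List using (List; []; _∷_; _++_; _∷ʳ_; [_]; map; length; unsnoc; initLast; _∷ʳ′_)
open import Data.List.Properties using (∷-injective)
open import Data.List.Membership.Propositional using (_∈_)
open import Data.List.Relation.Unary.Any using (here)
open import Data.Maybe using (Maybe; just; nothing)
open import Data.Nat using (zero; _+_; _≤_; _<_; s≤s; z≤n)
open import Data.Nat.Properties using (*-zeroʳ; +-identityʳ)
open import Data.Product using (Σ; ∃; _×_; _,_; proj₁; proj₂)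
open import Data.Sum using (inj₁)
open import Data.Unit using (⊤; tt)
open import Function using (_∘_; case_of_)
open import Function.Bundles using (_↔_; _⇔_; Inverse; Equivalence; mk⇔)
open import Function.Definitions using (Injective)
open import Function.Properties.Inverse using (↔⇒↣)
open import Relation.Binary.Definitions using (DecidableEquality)
open import Relation.Binary.PropositionalEquality
  using (_≡_; _≢_; refl; sym; trans; cong; cong₂; subst)
open import Relation.Nullary using (¬_; Dec; yes; ⌊_⌋; map′; _×-dec_)
open import Relation.Nullary.Decidable using (via-injection; toWitness; fromWitness)
open import Relation.Unary using (Pred; Decidable)

initLast-∷ʳ : ∀ {a} {A : Set a} (xs : List A) (x : A) → initLast (xs ∷ʳ x) ≡ xs ∷ʳ′ x
initLast-∷ʳ []       x = refl
initLast-∷ʳ (y ∷ xs) x rewrite initLast-∷ʳ xs x = refl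

unsnoc-∷ʳ : ∀ {a} {A : Set a} (xs : List A) (x : A) → unsnoc (xs ∷ʳ x) ≡ just (xs , x)
unsnoc-∷ʳ xs x rewrite initLast-∷ʳ xs x = refl

∃?-finite : ∀ {a p n} {A : Set a} {P : Pred A p} → A ↔ Fin n → Decidable P → Dec (∃ P)
∃?-finite {P = P} A↔Fin P? = map′
  (λ (i , pi) → from i , pi)
  (λ (x , px) → to x , subst P (sym (strictlyInverseʳ x)) px)
  (any? (P? ∘ from))
  where open Inverse A↔Fin

map-image? : ∀ {a b} {A : Set a} {B : Set b} {f : A → B} →
  (∀ y → Dec (∃ λ x → f x ≡ y)) → ∀ ys → Dec (∃ λ xs → map f xs ≡ ys)
map-image? f? [] = yes ([] , refl)
map-image? f? (y ∷ ys) = map′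
  (λ ((x , fx≡y) , (xs , fxs≡ys)) → x ∷ xs , cong₂ _∷_ fx≡y fxs≡ys)
  (λ { ([] , ()) ; (x ∷ xs , e) → (x , proj₁ (∷-injective e)) , (xs , proj₂ (∷-injective e)) })
  (f? y ×-dec map-image? f? ys)

evalPoly-const : ∀ c n → evalPoly (c ∷ []) n ≡ c
evalPoly-const c n = trans (cong (c +_) (*-zeroʳ n)) (+-identityʳ c)

short-nonempty-image : ∀ {a b} {A : Set a} {B : Set b} (x : A) (f : List A → List B) →
  Injective _≡_ _≡_ f → ∃ λ ys → length ys ≤ 1 × f ys ≢ []
short-nonempty-image x f f-inj with f [] in f[]≡
... | _ ∷ _ = [] , z≤n , λ f[]≡[] → case trans (sym f[]≡) f[]≡[] of λ ()
... | []    = [ x ] , s≤s z≤n , λ f[x]≡[] → case f-inj (trans f[]≡ (sym f[x]≡[])) of λ ()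

module Model (A : Alphabets) where
  open Alphabets A
  open Machines A

  _≟Γ_ : DecidableEquality Γₐ
  _≟Γ_ = via-injection (↔⇒↣ Γ-finite) _≟Fin_

  word? : (r : List Γₐ) → Dec (∃ λ x → ⌜ x ⌝ ≡ r)
  word? = map-image? (λ g → ∃?-finite Σ-finite (λ s → emb s ≟Γ g))

  -- The left side of the instruction is ignored: A1 only concerns matching instructions.
  shift : List Γₐ → Γₐ → List Γₐ → Inst → Maybe Conf
  shift l z []      [ _ , _ ⇒ p , c , R ] = nothing
  shift l z (b ∷ r) [ _ , _ ⇒ p , c , R ] = just (conf p (l ++ z ∷ c ∷ []) b r)
  shift l z r       [ _ , _ ⇒ p , c , L ] = just (conf p l z (c ∷ r))

  leftEnd : State → List Γₐ → Maybe Conf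
  leftEnd (q zero) r@(_ ∷ _) = just (conf h [] blank r)
  leftEnd _        _         = nothing

  tb : Conf → Inst → Maybe Conf
  tb (conf s l a r) τ with unsnoc l
  ... | just (l′ , z) = shift l′ z r τ
  ... | nothing       = leftEnd s r

  sb : Conf → Bool
  sb (conf h [] a r) = ⌊ a ≟Γ blank ×-dec word? r ⌋
  sb _               = false

  model : Interp
  model = record { TB = tb ; SB = sb }

  axA1 : AxA1 model
  axA1 x y a b₁ b₂ c s p rewrite unsnoc-∷ʳ ⌜ x ⌝ (emb b₁) = refl , refl

  axA2 : AxA2 model
  axA2 (conf h [] a r) accepts
    with refl , x , refl ← toWitness {a? = a ≟Γ blank ×-dec word? r} (Equivalence.from T-≡ accepts)
    = x , inj₁ refl

  axA3 : AxA3 model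
  axA3 x = Equivalence.to T-≡ (fromWitness {a? = blank ≟Γ blank ×-dec word? ⌜ x ⌝} (refl , x , refl))

  []∉L : ∀ M → ¬ InL model M []
  []∉L M (_ , _ , done , () , _)
  []∉L M (_ , _ , step _ _ () _ , _)

  time≡1 : ∀ {M x n} → TimeIs model M x n → n ≡ 1
  time≡1 (_ , done , () , _)
  time≡1 {x = []}    (_ , step _ _ () _ , _)
  time≡1 {x = _ ∷ _} (_ , step _ _ refl done , _) = refl
  time≡1 {x = _ ∷ _} (_ , step _ _ refl (step _ _ () _) , _)

  nonempty∈L : ∀ {M τ x} → τ ∈ M → x ≢ [] → InL model M x
  nonempty∈L {x = []}    _   x≢[] = ⊥-elim (x≢[] refl)
  nonempty∈L {x = s ∷ x} τ∈M _    = 1 , _ , step _ τ∈M refl done , axA3 (s ∷ x) , λ _ _ → refl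

  singleton : Inst → Ξ
  singleton τ = [ τ ] , λ { (here refl) (here refl) _ _ → refl }

  NonEmpty : Language model
  NonEmpty x = x ≢ []

  Full : Language model
  Full _ = ⊤

  NonEmpty∈P : InP model NonEmpty
  NonEmpty∈P = singleton [ h , blank ⇒ h , blank , R ] , 2 ∷ [] , decides , fast
    where
    decides : ∀ x → NonEmpty x ⇔ InL model _ x
    decides x = mk⇔ (nonempty∈L (here refl)) λ { accepts refl → []∉L _ accepts }

    fast : ∀ x → NonEmpty x → ∀ n → TimeIs model _ x n → n < evalPoly (2 ∷ []) (length x)
    fast x _ n t rewrite time≡1 t | evalPoly-const 2 (length x) = s≤s (s≤s z≤n)

  Full∉P : ¬ InP model Full
  Full∉P ((M , _) , _ , decides , _) = []∉L M (Equivalence.to (decides []) tt)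

  Full∈NP : (pair : Word → Word → Word) →
    (∀ {x y x′ y′} → pair x y ≡ pair x′ y′ → (x ≡ x′) × (y ≡ y′)) →
    InNP model pair Full
  Full∈NP pair pair-inj = NonEmpty , NonEmpty∈P , 1 ∷ [] , λ x → mk⇔ (λ _ → certificate x) (λ _ → tt)
    where
    certificate : ∀ x → ∃ λ y → length y ≤ evalPoly (1 ∷ []) (length x) × NonEmpty (pair x y)
    certificate x with y , |y|≤1 , nonempty ← short-nonempty-image Σ-nonempty (pair x)
                        (λ {y} {y′} e → proj₂ (pair-inj {x} {y} {x} {y′} e))
      = y , subst (length y ≤_) (sym (evalPoly-const 1 (length x))) |y|≤1 , nonempty

mainTheorem7 : (A : Alphabets) →
    (pair : Machines.Word A → Machines.Word A → Machines.Word A) →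
    (∀ {x y x′ y′} → pair x y ≡ pair x′ y′ → (x ≡ x′) × (y ≡ y′)) →
    Σ (Machines.Interp A) λ I →
      Machines.AxA1 A I × Machines.AxA2 A I × Machines.AxA3 A I
      × ¬ Machines.PeqNP A I pair
mainTheorem7 A pair pair-inj =
  model , axA1 , axA2 , axA3 ,
  λ P=NP → Full∉P (Equivalence.from (P=NP Full) (Full∈NP pair pair-inj))
  where open Model A
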